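{- Let $G$ be a graph, $S\subseteq V(G)$, and $D_S$ a proper $k$-orientation of $G[S]$ such that for every $v\in V(G)\setminus S$ and every $u\in N(v)\cap S$ we have $|N(v)\cap S|>d^-_{D_S}(u)$. Then $D_S$ can be extended to a proper $\Delta(G)$-orientation $D$ of $G$ (i.e. $D$ agrees with $D_S$ on the edges of $G[S]$) such that $d^-_D(v)=d^-_{D_S}(v)$ for every $v\in S$, and $d^-_D(v)\leq d_G(v)$ for every $v\in V(G)\setminus S$.
   Context: An orientation $D$ of a graph $G$ replaces each edge by exactly one of its two possible arcs; $d^-_D(v)$ is the indegree of $v$. $D$ is proper if adjacent vertices have distinct indegrees; a $k$-orientation has maximum indegree at most $k$. $\Delta(G)$ is the maximum degree and $d_G(v)$ the degree of $v$. -}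

module Defs where

open import Data.Nat using (ℕ; zero; suc; _+_; _≤_; _<_; _⊔_)
open import Data.Fin using (Fin; zero; suc)
open import Data.Bool using (Bool; true; false; _∧_; _∨_; if_then_else_)
open import Data.Product using (Σ; _×_)
open import Relation.Binary.PropositionalEquality using (_≡_; _≢_)

count : ∀ {n} → (Fin n → Bool) → ℕ
count {zero}  f = 0
count {suc n} f = (if f zero then 1 else 0) + count (λ i → f (suc i))

maxFin : ∀ {n} → (Fin n → ℕ) → ℕ
maxFin {zero}  f = 0
maxFin {suc n} f = f zero ⊔ maxFin (λ i → f (suc i))

record Graph (n : ℕ) : Set where
  field
    adj   : Fin n → Fin n → Bool
    sym   : ∀ u v → adj u v ≡ adj v u
    irrfl : ∀ v → adj v v ≡ false
open Graph public

deg : ∀ {n} → Graph n → Fin n → ℕ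
deg G v = count (λ u → adj G u v)

Δ : ∀ {n} → Graph n → ℕ
Δ G = maxFin (deg G)

-- induced subgraph G[S]; vertices outside S are kept as isolated vertices
-- (they carry no edges, so they do not affect orientations or indegrees of S)
induced : ∀ {n} → Graph n → (Fin n → Bool) → Graph n
induced {n} G S = record { adj = a ; sym = s ; irrfl = i }
  where
  open import Relation.Binary.PropositionalEquality using (cong₂; refl)
  open import Data.Bool.Properties using (∧-comm; ∧-assoc)
  a : Fin n → Fin n → Bool
  a u v = adj G u v ∧ (S u ∧ S v)
  s : ∀ u v → a u v ≡ a v u
  s u v = cong₂ _∧_ (sym G u v) (∧-comm (S u) (S v))
  i : ∀ v → a v v ≡ false
  i v rewrite irrfl G v = refl

-- an orientation: D u v ≡ true means the arc u → v.
-- each edge is replaced by exactly one of its two arcs, non-edges get no arc.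
IsOrientation : ∀ {n} (G : Graph n) → (Fin n → Fin n → Bool) → Set
IsOrientation {n} G D =
  (∀ u v → D u v ∨ D v u ≡ adj G u v) × (∀ u v → D u v ∧ D v u ≡ false)

indeg : ∀ {n} → (Fin n → Fin n → Bool) → Fin n → ℕ
indeg D v = count (λ u → D u v)

IsProper : ∀ {n} (G : Graph n) → (Fin n → Fin n → Bool) → Set
IsProper G D = ∀ u v → adj G u v ≡ true → indeg D u ≢ indeg D v

IsProperKOrientation : ∀ {n} (G : Graph n) → ℕ → (Fin n → Fin n → Bool) → Set
IsProperKOrientation G k D =
  IsOrientation G D × IsProper G D × (∀ v → indeg D v ≤ k)

-- Orient the edges of G[S] as in D_S, every edge between S and its complement
-- away from S, and the remaining edges arbitrarily.  A vertex v outside S then has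
-- indegree at least |N(v) ∩ S|, which exceeds the indegree of each of its
-- neighbours in S, so only edges with both ends outside S can join vertices of
-- equal indegree.  Reversing such an arc a → b (with d⁻(a) = d⁻(b) = t) raises
-- Σ_v d⁻(v)² by 2 and touches no arc at S; as that sum is bounded by Σ_v d(v)²,
-- repeating this ends in a proper orientation.  Indegrees never exceed degrees,
-- whence the Δ(G) bound.

module Submission where

open import Defs hiding (sym)
open import Data.Nat using (ℕ; zero; suc; _+_; _*_; _≤_; _<_; z≤n; s≤s)
import Data.Nat as ℕ
open import Data.Nat.Properties
  using ( +-0-commutativeMonoid; +-comm; +-identityʳ; +-suc; +-cancelʳ-≡; +-mono-≤; +-monoʳ-≤; *-mono-≤
        ; ≤-trans; ≤-reflexive; <-≤-trans; <⇒≢; <⇒≱; m≤m+n; m<m+n; m≤n⇒m≤1+n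
        ; m≤m⊔n; m≤n⇒m≤o⊔n; module ≤-Reasoning)
open import Data.Nat.Tactic.RingSolver using (solve-∀)
open import Data.Fin using (Fin; punchIn; _≟_; _<?_)
import Data.Fin as Fin
open import Data.Fin.Properties using (punchInᵢ≢i; any?; <-cmp)
open import Data.Vec.Functional using (Vector; updateAt)
open import Data.Vec.Functional.Properties using (updateAt-updates; updateAt-minimal)
open import Data.Bool using (Bool; true; false; _∧_; _∨_; if_then_else_)
import Data.Bool as Bool
open import Data.Bool.Properties
  using (∨-comm; ∨-identityʳ; ∨-conicalˡ; ∧-identityʳ; ∧-zeroʳ; ∧-conicalˡ; ∧-conicalʳ)
open import Data.Product using (Σ; Σ-syntax; ∃₂; _×_; _,_; proj₁; proj₂; swap)
open import Data.Sum using (_⊎_; inj₁; inj₂)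
import Data.Sum as Sum
open import Function using (_∘_; const)
open import Relation.Binary using (tri<; tri≈; tri>)
open import Relation.Nullary using (¬_; Dec; yes; no; does; _×-dec_; _⊎-dec_; contradiction)
open import Relation.Nullary.Decidable using (dec-true; dec-false)
open import Relation.Binary.PropositionalEquality
  using (_≡_; _≢_; refl; sym; trans; cong; cong₂; subst; ≢-sym; module ≡-Reasoning)
open import Algebra.Properties.CommutativeMonoid.Sum +-0-commutativeMonoid
  using (sum; sum-remove; sum-cong-≗)

sum-mono-≤ : ∀ {n} (f g : Vector ℕ n) → (∀ i → f i ≤ g i) → sum f ≤ sum g
sum-mono-≤ {zero}  f g f≤g = z≤n
sum-mono-≤ {suc n} f g f≤g =
  +-mono-≤ (f≤g Fin.zero) (sum-mono-≤ (f ∘ Fin.suc) (g ∘ Fin.suc) (f≤g ∘ Fin.suc))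

sum-agreeOff : ∀ {n} (f g : Vector ℕ n) (i : Fin n) → (∀ j → j ≢ i → f j ≡ g j) →
  sum f + g i ≡ sum g + f i
sum-agreeOff {suc n} f g i f≡g = begin
  sum f + g i                                ≡⟨ cong (_+ g i) (sum-remove f) ⟩
  f i + sum (f ∘ punchIn i) + g i            ≡⟨ cong (λ r → f i + r + g i) rest ⟩
  f i + sum (g ∘ punchIn i) + g i            ≡⟨ swap-ends (f i) _ (g i) ⟩
  g i + sum (g ∘ punchIn i) + f i            ≡⟨ cong (_+ f i) (sym (sum-remove g)) ⟩
  sum g + f i                                ∎
  where
  open ≡-Reasoning
  rest : sum (f ∘ punchIn i) ≡ sum (g ∘ punchIn i)
  rest = sum-cong-≗ (λ j → f≡g (punchIn i j) (punchInᵢ≢i i j))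
  swap-ends : ∀ x r y → x + r + y ≡ y + r + x
  swap-ends = solve-∀

sum-agreeOff₂ : ∀ {n} (f g : Vector ℕ n) {a b : Fin n} → a ≢ b →
  (∀ j → j ≢ a → j ≢ b → f j ≡ g j) → sum f + (g a + g b) ≡ sum g + (f a + f b)
sum-agreeOff₂ f g {a} {b} a≢b f≡g = begin
  sum f + (g a + g b)      ≡⟨ reassoc (sum f) (g a) (g b) ⟩
  sum f + g a + g b        ≡⟨ cong (_+ g b) (sym f→h) ⟩
  sum h + f a + g b        ≡⟨ swap-last (sum h) (f a) (g b) ⟩
  sum h + g b + f a        ≡⟨ cong (_+ f a) (sym h→g) ⟩
  sum g + h b + f a        ≡⟨ cong (λ x → sum g + x + f a) hb≡fb ⟩
  sum g + f b + f a        ≡⟨ swap-last′ (sum g) (f b) (f a) ⟩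
  sum g + (f a + f b)      ∎
  where
  open ≡-Reasoning
  h : Vector ℕ _
  h = updateAt f a (const (g a))
  hb≡fb : h b ≡ f b
  hb≡fb = updateAt-minimal b a f (a≢b ∘ sym)
  f→h : sum h + f a ≡ sum f + g a
  f→h = trans (sum-agreeOff h f a (λ j j≢a → updateAt-minimal j a f j≢a))
              (cong (sum f +_) (updateAt-updates a f))
  g≡h : ∀ j → j ≢ b → g j ≡ h j
  g≡h j j≢b with j ≟ a
  ... | yes refl = sym (updateAt-updates a f)
  ... | no j≢a   = trans (sym (f≡g j j≢a j≢b)) (sym (updateAt-minimal j a f j≢a))
  h→g : sum g + h b ≡ sum h + g b
  h→g = sum-agreeOff g h b g≡h
  reassoc : ∀ s x y → s + (x + y) ≡ s + x + y
  reassoc = solve-∀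
  swap-last : ∀ s x y → s + x + y ≡ s + y + x
  swap-last = solve-∀
  swap-last′ : ∀ s x y → s + x + y ≡ s + (y + x)
  swap-last′ = solve-∀

count≡sum : ∀ {n} (f : Fin n → Bool) → count f ≡ sum (λ i → if f i then 1 else 0)
count≡sum {zero}  f = refl
count≡sum {suc n} f = cong ((if f Fin.zero then 1 else 0) +_) (count≡sum (f ∘ Fin.suc))

count-cong : ∀ {n} {f g : Fin n → Bool} → (∀ i → f i ≡ g i) → count f ≡ count g
count-cong {f = f} {g} f≡g = begin
  count f                                  ≡⟨ count≡sum f ⟩
  sum (λ i → if f i then 1 else 0)         ≡⟨ sum-cong-≗ (λ i → cong (if_then 1 else 0) (f≡g i)) ⟩
  sum (λ i → if g i then 1 else 0)         ≡⟨ sym (count≡sum g) ⟩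
  count g                                  ∎
  where open ≡-Reasoning

count-mono : ∀ {n} (f g : Fin n → Bool) → (∀ i → f i ≡ true → g i ≡ true) → count f ≤ count g
count-mono {zero}  f g f⇒g = z≤n
count-mono {suc n} f g f⇒g with f Fin.zero in f₀ | g Fin.zero in g₀
... | true  | true  = s≤s (count-mono (f ∘ Fin.suc) (g ∘ Fin.suc) (f⇒g ∘ Fin.suc))
... | true  | false with () ← trans (sym (f⇒g Fin.zero f₀)) g₀
... | false | true  = m≤n⇒m≤1+n (count-mono (f ∘ Fin.suc) (g ∘ Fin.suc) (f⇒g ∘ Fin.suc))
... | false | false = count-mono (f ∘ Fin.suc) (g ∘ Fin.suc) (f⇒g ∘ Fin.suc)

count-agreeOff : ∀ {n} (f g : Fin n → Bool) (i : Fin n) → (∀ j → j ≢ i → f j ≡ g j) →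
  f i ≡ true → g i ≡ false → count f ≡ suc (count g)
count-agreeOff f g i f≡g fᵢ gᵢ = begin
  count f              ≡⟨ sym (+-identityʳ (count f)) ⟩
  count f + 0          ≡⟨ cong₂ _+_ (count≡sum f) (cong (if_then 1 else 0) (sym gᵢ)) ⟩
  sum f′ + g′ i        ≡⟨ sum-agreeOff f′ g′ i (λ j j≢i → cong (if_then 1 else 0) (f≡g j j≢i)) ⟩
  sum g′ + f′ i        ≡⟨ cong₂ _+_ (sym (count≡sum g)) (cong (if_then 1 else 0) fᵢ) ⟩
  count g + 1          ≡⟨ +-comm (count g) 1 ⟩
  suc (count g)        ∎
  where
  open ≡-Reasoning
  f′ g′ : Vector ℕ _
  f′ j = if f j then 1 else 0
  g′ j = if g j then 1 else 0

maxFin-upperBound : ∀ {n} (f : Fin n → ℕ) i → f i ≤ maxFin f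
maxFin-upperBound f Fin.zero    = m≤m⊔n _ _
maxFin-upperBound f (Fin.suc i) = m≤n⇒m≤o⊔n (f Fin.zero) (maxFin-upperBound (f ∘ Fin.suc) i)

Orientation : ℕ → Set
Orientation n = Fin n → Fin n → Bool

indeg≤deg : ∀ {n} (G : Graph n) (D : Orientation n) → IsOrientation G D → ∀ v → indeg D v ≤ deg G v
indeg≤deg G D (covers , _) v = count-mono _ _ (λ u uv → trans (sym (covers u v)) (cong (_∨ D v u) uv))

Along : ∀ {n} → Fin n → Fin n → Fin n → Fin n → Set
Along a b x y = (x ≡ a × y ≡ b) ⊎ (x ≡ b × y ≡ a)

along? : ∀ {n} (a b x y : Fin n) → Dec (Along a b x y)
along? a b x y = (x ≟ a ×-dec y ≟ b) ⊎-dec (x ≟ b ×-dec y ≟ a)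

Along-swap : ∀ {n} {a b x y : Fin n} → Along a b x y → Along a b y x
Along-swap = Sum.swap ∘ Sum.map swap swap

reverseArc : ∀ {n} → Orientation n → Fin n → Fin n → Orientation n
reverseArc D a b x y = if does (along? a b x y) then D y x else D x y

module _ {n} (D : Orientation n) (a b : Fin n) where

  reverseArc-along : ∀ {x y} → Along a b x y → reverseArc D a b x y ≡ D y x
  reverseArc-along {x} {y} along rewrite dec-true (along? a b x y) along = refl

  reverseArc-¬along : ∀ {x y} → ¬ Along a b x y → reverseArc D a b x y ≡ D x y
  reverseArc-¬along {x} {y} ¬along rewrite dec-false (along? a b x y) ¬along = refl

  reverseArc-swapsOrKeeps : ∀ u v →
    (reverseArc D a b u v ≡ D v u × reverseArc D a b v u ≡ D u v) ⊎
    (reverseArc D a b u v ≡ D u v × reverseArc D a b v u ≡ D v u)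
  reverseArc-swapsOrKeeps u v with along? a b u v
  ... | yes along = inj₁ (reverseArc-along along , reverseArc-along (Along-swap along))
  ... | no ¬along = inj₂ (reverseArc-¬along ¬along , reverseArc-¬along (¬along ∘ Along-swap))

reverseArc-isOrientation : ∀ {n} (G : Graph n) (D : Orientation n) a b →
  IsOrientation G D → IsOrientation G (reverseArc D a b)
reverseArc-isOrientation G D a b (covers , antisym) = covers′ , antisym′
  where
  covers′ : ∀ u v → reverseArc D a b u v ∨ reverseArc D a b v u ≡ adj G u v
  covers′ u v with reverseArc-swapsOrKeeps D a b u v
  ... | inj₁ (p , q) = trans (cong₂ _∨_ p q) (trans (∨-comm (D v u) (D u v)) (covers u v))
  ... | inj₂ (p , q) = trans (cong₂ _∨_ p q) (covers u v)
  antisym′ : ∀ u v → reverseArc D a b u v ∧ reverseArc D a b v u ≡ false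
  antisym′ u v with reverseArc-swapsOrKeeps D a b u v
  ... | inj₁ (p , q) = trans (cong₂ _∧_ p q) (antisym v u)
  ... | inj₂ (p , q) = trans (cong₂ _∧_ p q) (antisym u v)

module _ {n} (G : Graph n) (D : Orientation n) (isOri : IsOrientation G D)
         {a b : Fin n} (ab : D a b ≡ true) where

  private
    D′ : Orientation n
    D′ = reverseArc D a b

  private
    ¬ba : D b a ≡ false
    ¬ba = trans (sym (cong (_∧ D b a) ab)) (proj₂ isOri a b)

  arc-endpoints-distinct : a ≢ b
  arc-endpoints-distinct refl with () ← trans (sym ab) ¬ba

  private
    a≢b = arc-endpoints-distinct

  indeg-reverseArc-head : indeg D b ≡ suc (indeg D′ b)
  indeg-reverseArc-head = count-agreeOff (λ x → D x b) (λ x → D′ x b) a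
    (λ x x≢a → sym (reverseArc-¬along D a b λ
      { (inj₁ (x≡a , _)) → x≢a x≡a ; (inj₂ (_ , b≡a)) → a≢b (sym b≡a) }))
    ab (trans (reverseArc-along D a b (inj₁ (refl , refl))) ¬ba)

  indeg-reverseArc-tail : indeg D′ a ≡ suc (indeg D a)
  indeg-reverseArc-tail = count-agreeOff (λ x → D′ x a) (λ x → D x a) b
    (λ x x≢b → reverseArc-¬along D a b λ
      { (inj₁ (_ , a≡b)) → a≢b a≡b ; (inj₂ (x≡b , _)) → x≢b x≡b })
    (trans (reverseArc-along D a b (inj₂ (refl , refl))) ab) ¬ba

  indeg-reverseArc-other : ∀ {v} → v ≢ a → v ≢ b → indeg D′ v ≡ indeg D v
  indeg-reverseArc-other {v} v≢a v≢b = count-cong {f = λ x → D′ x v} (λ x → reverseArc-¬along D a b λ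
    { (inj₁ (_ , v≡b)) → v≢b v≡b ; (inj₂ (_ , v≡a)) → v≢a v≡a })

potential : ∀ {n} → Orientation n → ℕ
potential D = sum (λ v → indeg D v * indeg D v)

potential≤ : ∀ {n} (G : Graph n) (D : Orientation n) → IsOrientation G D →
  potential D ≤ sum (λ v → deg G v * deg G v)
potential≤ G D isOri = sum-mono-≤ _ _ (λ v → *-mono-≤ (indeg≤deg G D isOri v) (indeg≤deg G D isOri v))

-- (s + 2)² + s² = 2 (s + 1)² + 2
squares-spread-< : ∀ m m′ s →
  m + (suc (suc s) * suc (suc s) + s * s) ≡ m′ + (suc s * suc s + suc s * suc s) → m < m′
squares-spread-< m m′ s eq = subst (m <_) m+2≡m′ (m<m+n m (s≤s z≤n))
  where
  rearrange : ∀ m s →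
    m + (suc (suc s) * suc (suc s) + s * s) ≡ (m + 2) + (suc s * suc s + suc s * suc s)
  rearrange = solve-∀
  m+2≡m′ : m + 2 ≡ m′
  m+2≡m′ = +-cancelʳ-≡ _ (m + 2) m′ (trans (sym (rearrange m s)) eq)

-- With t the common indegree of a and b, the squares t², t² become (t + 1)², (t - 1)².
potential-reverseArc : ∀ {n} (G : Graph n) (D : Orientation n) → IsOrientation G D →
  ∀ {a b} → D a b ≡ true → indeg D a ≡ indeg D b → potential D < potential (reverseArc D a b)
potential-reverseArc G D isOri {a} {b} ab a∼b =
  squares-spread-< (potential D) (potential D′) s (begin
    potential D + (suc (suc s) * suc (suc s) + s * s)
      ≡⟨ cong (λ x → potential D + (x * x + s * s)) (sym tail) ⟩
    potential D + (sq′ a + sq′ b)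
      ≡⟨ sum-agreeOff₂ sq sq′ (arc-endpoints-distinct G D isOri ab) other ⟩
    potential D′ + (sq a + sq b)
      ≡⟨ cong₂ (λ x y → potential D′ + (x * x + y * y)) (trans a∼b head) head ⟩
    potential D′ + (suc s * suc s + suc s * suc s) ∎)
  where
  open ≡-Reasoning
  D′ = reverseArc D a b
  sq sq′ : Fin _ → ℕ
  sq  v = indeg D v * indeg D v
  sq′ v = indeg D′ v * indeg D′ v
  s = indeg D′ b
  head : indeg D b ≡ suc s
  head = indeg-reverseArc-head G D isOri ab
  tail : indeg D′ a ≡ suc (suc s)
  tail = trans (indeg-reverseArc-tail G D isOri ab) (cong suc (trans a∼b head))
  other : ∀ v → v ≢ a → v ≢ b → sq v ≡ sq′ v
  other v v≢a v≢b = cong (λ x → x * x) (sym (indeg-reverseArc-other G D isOri ab v≢a v≢b))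

orientByIndex : ∀ {n} → Graph n → Orientation n
orientByIndex G u v = does (u <? v) ∧ adj G u v

orientByIndex-< : ∀ {n} (G : Graph n) {u v} → u Fin.< v → ¬ v Fin.< u →
  orientByIndex G u v ≡ adj G u v × orientByIndex G v u ≡ false
orientByIndex-< G {u} {v} u<v v≮u =
  cong (_∧ adj G u v) (dec-true (u <? v) u<v) , cong (_∧ adj G v u) (dec-false (v <? u) v≮u)

orientByIndex-isOrientation : ∀ {n} (G : Graph n) → IsOrientation G (orientByIndex G)
orientByIndex-isOrientation G = covers , antisym
  where
  loop : ∀ {u} → ¬ u Fin.< u → orientByIndex G u u ≡ false
  loop {u} u≮u = cong (_∧ adj G u u) (dec-false (u <? u) u≮u)
  covers : ∀ u v → orientByIndex G u v ∨ orientByIndex G v u ≡ adj G u v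
  covers u v with <-cmp u v
  ... | tri< u<v _ v≮u  = let (p , q) = orientByIndex-< G u<v v≮u in
    trans (cong₂ _∨_ p q) (∨-identityʳ _)
  ... | tri≈ u≮u refl _ = trans (cong₂ _∨_ (loop u≮u) (loop u≮u)) (sym (irrfl G u))
  ... | tri> u≮v _ v<u  = let (p , q) = orientByIndex-< G v<u u≮v in
    trans (cong₂ _∨_ q p) (Graph.sym G v u)
  antisym : ∀ u v → orientByIndex G u v ∧ orientByIndex G v u ≡ false
  antisym u v with <-cmp u v
  ... | tri< u<v _ v≮u  = let (p , q) = orientByIndex-< G u<v v≮u in
    trans (cong₂ _∧_ p q) (∧-zeroʳ _)
  ... | tri≈ u≮u refl _ = cong (_∧ orientByIndex G u u) (loop u≮u)
  ... | tri> u≮v _ v<u  = let (p , q) = orientByIndex-< G v<u u≮v in cong₂ _∧_ q p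

module _ {n} (G : Graph n) (S : Fin n → Bool) where

  AgreeTouchingS : Orientation n → Orientation n → Set
  AgreeTouchingS D D₀ = ∀ u v → S u ≡ true ⊎ S v ≡ true → D u v ≡ D₀ u v

  ProperOutsideS : Orientation n → Set
  ProperOutsideS D = ∀ a b → S a ≡ false → S b ≡ false → adj G a b ≡ true → indeg D a ≢ indeg D b

  ClashOutsideS : Orientation n → Set
  ClashOutsideS D = ∃₂ λ a b → S a ≡ false × S b ≡ false × D a b ≡ true × indeg D a ≡ indeg D b

  clashOutsideS? : ∀ D → Dec (ClashOutsideS D)
  clashOutsideS? D = any? λ a → any? λ b →
    (S a Bool.≟ false) ×-dec (S b Bool.≟ false) ×-dec (D a b Bool.≟ true) ×-dec (indeg D a ℕ.≟ indeg D b)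

  ¬clash⇒properOutsideS : ∀ D → IsOrientation G D → ¬ ClashOutsideS D → ProperOutsideS D
  ¬clash⇒properOutsideS D (covers , _) ¬clash a b a∉S b∉S ab a∼b with D a b in ab′ | D b a in ba′
  ... | true  | _     = ¬clash (a , b , a∉S , b∉S , ab′ , a∼b)
  ... | false | true  = ¬clash (b , a , b∉S , a∉S , ba′ , sym a∼b)
  ... | false | false with () ← trans (sym ab) (trans (sym (covers a b)) (cong₂ _∨_ ab′ ba′))

  reverseArc-agreeTouchingS : ∀ D {a b} → S a ≡ false → S b ≡ false → AgreeTouchingS (reverseArc D a b) D
  reverseArc-agreeTouchingS D {a} {b} a∉S b∉S u v touches = reverseArc-¬along D a b (avoids touches)
    where
    outside≢inside : ∀ {x y} → S x ≡ false → S y ≡ true → x ≢ y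
    outside≢inside x∉S y∈S refl with () ← trans (sym x∉S) y∈S
    avoids : S u ≡ true ⊎ S v ≡ true → ¬ Along a b u v
    avoids (inj₁ u∈S) (inj₁ (u≡a , _)) = outside≢inside a∉S u∈S (sym u≡a)
    avoids (inj₁ u∈S) (inj₂ (u≡b , _)) = outside≢inside b∉S u∈S (sym u≡b)
    avoids (inj₂ v∈S) (inj₁ (_ , v≡b)) = outside≢inside b∉S v∈S (sym v≡b)
    avoids (inj₂ v∈S) (inj₂ (_ , v≡a)) = outside≢inside a∉S v∈S (sym v≡a)

  private
    bound : ℕ
    bound = sum (λ v → deg G v * deg G v)

    fuel-step : ∀ fuel {p p′} → bound < suc fuel + p → p < p′ → bound < fuel + p′
    fuel-step fuel {p} bound< p<p′ =
      <-≤-trans bound< (≤-trans (≤-reflexive (sym (+-suc fuel p))) (+-monoʳ-≤ fuel p<p′))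

    -- Each reversal raises the potential, which never exceeds bound.
    search : ∀ fuel D → IsOrientation G D → bound < fuel + potential D →
      Σ[ D′ ∈ Orientation n ] IsOrientation G D′ × AgreeTouchingS D′ D × ProperOutsideS D′
    search zero D isOri bound< = contradiction (potential≤ G D isOri) (<⇒≱ bound<)
    search (suc fuel) D isOri bound< with clashOutsideS? D
    ... | no ¬clash = D , isOri , (λ _ _ _ → refl) , ¬clash⇒properOutsideS D isOri ¬clash
    ... | yes (a , b , a∉S , b∉S , ab , a∼b)
      with search fuel (reverseArc D a b) (reverseArc-isOrientation G D a b isOri)
                  (fuel-step fuel bound< (potential-reverseArc G D isOri ab a∼b))
    ...   | D′ , isOri′ , agree , proper =
      D′ , isOri′ , (λ u v t → trans (agree u v t) (reverseArc-agreeTouchingS D a∉S b∉S u v t)) , proper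

  properOutsideS-extension : ∀ D₀ → IsOrientation G D₀ →
    Σ[ D ∈ Orientation n ] IsOrientation G D × AgreeTouchingS D D₀ × ProperOutsideS D
  properOutsideS-extension D₀ isOri = search (suc bound) D₀ isOri (s≤s (m≤m+n bound (potential D₀)))

module _ {n} (G : Graph n) (S : Fin n → Bool) where

  induced-adj-inside : ∀ {u v} → S u ≡ true → S v ≡ true → adj (induced G S) u v ≡ adj G u v
  induced-adj-inside {u} {v} u∈S v∈S =
    trans (cong (adj G u v ∧_) (cong₂ _∧_ u∈S v∈S)) (∧-identityʳ _)

  induced-orientation-outside : ∀ D → IsOrientation (induced G S) D →
    ∀ {u v} → S u ≡ false ⊎ S v ≡ false → D u v ≡ false
  induced-orientation-outside D (covers , _) {u} {v} outside =
    ∨-conicalˡ (D u v) (D v u)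
      (trans (covers u v) (trans (cong (adj G u v ∧_) (meets outside)) (∧-zeroʳ _)))
    where
    meets : S u ≡ false ⊎ S v ≡ false → S u ∧ S v ≡ false
    meets (inj₁ u∉S) = cong (_∧ S v) u∉S
    meets (inj₂ v∉S) = trans (cong (S u ∧_) v∉S) (∧-zeroʳ (S u))

  extendOutwards : Orientation n → Orientation n
  extendOutwards DS u v = if S v then DS u v else (if S u then adj G u v else orientByIndex G u v)

  extendOutwards-intoS : ∀ DS {u v} → S v ≡ true → extendOutwards DS u v ≡ DS u v
  extendOutwards-intoS DS v∈S rewrite v∈S = refl

  extendOutwards-outOfS : ∀ DS {u v} → S u ≡ true → S v ≡ false → extendOutwards DS u v ≡ adj G u v
  extendOutwards-outOfS DS u∈S v∉S rewrite u∈S | v∉S = refl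

  extendOutwards-isOrientation : ∀ DS → IsOrientation (induced G S) DS →
    IsOrientation G (extendOutwards DS)
  extendOutwards-isOrientation DS isOriS = covers , antisym
    where
    DS-outside : ∀ {u v} → S u ≡ false ⊎ S v ≡ false → DS u v ≡ false
    DS-outside = induced-orientation-outside DS isOriS
    covers : ∀ u v → extendOutwards DS u v ∨ extendOutwards DS v u ≡ adj G u v
    covers u v with S u in u∈S | S v in v∈S
    ... | true  | true  = trans (proj₁ isOriS u v) (induced-adj-inside u∈S v∈S)
    ... | true  | false = trans (cong (adj G u v ∨_) (DS-outside (inj₁ v∈S))) (∨-identityʳ _)
    ... | false | true  = trans (cong (_∨ adj G v u) (DS-outside (inj₁ u∈S))) (Graph.sym G v u)
    ... | false | false = proj₁ (orientByIndex-isOrientation G) u v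
    antisym : ∀ u v → extendOutwards DS u v ∧ extendOutwards DS v u ≡ false
    antisym u v with S u in u∈S | S v in v∈S
    ... | true  | true  = proj₂ isOriS u v
    ... | true  | false = trans (cong (adj G u v ∧_) (DS-outside (inj₁ v∈S))) (∧-zeroʳ _)
    ... | false | true  = cong (_∧ adj G v u) (DS-outside (inj₁ u∈S))
    ... | false | false = proj₂ (orientByIndex-isOrientation G) u v

  module _ {DS D : Orientation n} (agree : AgreeTouchingS G S D (extendOutwards DS)) where

    agreeDS : ∀ u {v} → S v ≡ true → D u v ≡ DS u v
    agreeDS u v∈S = trans (agree u _ (inj₂ v∈S)) (extendOutwards-intoS DS v∈S)

    indeg-inS : ∀ {v} → S v ≡ true → indeg D v ≡ indeg DS v
    indeg-inS {v} v∈S = count-cong {f = λ u → D u v} (λ u → agreeDS u v∈S)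

    neighboursInS≤indeg : ∀ {v} → S v ≡ false → count (λ w → adj G v w ∧ S w) ≤ indeg D v
    neighboursInS≤indeg {v} v∉S = count-mono _ _ λ w vw∧w∈S →
      trans (agree w v (inj₁ (∧-conicalʳ _ _ vw∧w∈S)))
        (trans (extendOutwards-outOfS DS (∧-conicalʳ _ _ vw∧w∈S) v∉S)
          (trans (Graph.sym G w v) (∧-conicalˡ _ _ vw∧w∈S)))

    module _ (crowded : ∀ v u → S v ≡ false → adj G v u ≡ true → S u ≡ true →
                         indeg DS u < count (λ w → adj G v w ∧ S w)) where

      indeg-across : ∀ {u v} → adj G u v ≡ true → S u ≡ true → S v ≡ false → indeg D u < indeg D v
      indeg-across {u} {v} uv u∈S v∉S = begin-strict
        indeg D u                      ≡⟨ indeg-inS u∈S ⟩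
        indeg DS u                     <⟨ crowded v u v∉S (trans (Graph.sym G v u) uv) u∈S ⟩
        count (λ w → adj G v w ∧ S w)  ≤⟨ neighboursInS≤indeg v∉S ⟩
        indeg D v                      ∎
        where open ≤-Reasoning

      isProper-extendOutwards : IsProper (induced G S) DS → ProperOutsideS G S D → IsProper G D
      isProper-extendOutwards properS properOut u v uv with S u in u∈S | S v in v∈S
      ... | true  | true  = λ eq → properS u v (trans (induced-adj-inside u∈S v∈S) uv)
                                     (trans (sym (indeg-inS u∈S)) (trans eq (indeg-inS v∈S)))
      ... | true  | false = <⇒≢ (indeg-across uv u∈S v∈S)
      ... | false | true  = ≢-sym (<⇒≢ (indeg-across (trans (Graph.sym G v u) uv) v∈S u∈S))
      ... | false | false = properOut u v u∈S v∈S uv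

proposition17 : ∀ {n} (G : Graph n) (S : Fin n → Bool) (k : ℕ) (DS : Fin n → Fin n → Bool) →
    IsProperKOrientation (induced G S) k DS →
    (∀ v u → S v ≡ false → adj G v u ≡ true → S u ≡ true →
      indeg DS u < count (λ w → adj G v w ∧ S w)) →
    Σ (Fin n → Fin n → Bool) λ D →
      IsProperKOrientation G (Δ G) D
      × (∀ u v → S u ≡ true → S v ≡ true → adj G u v ≡ true → D u v ≡ DS u v)
      × (∀ v → S v ≡ true → indeg D v ≡ indeg DS v)
      × (∀ v → S v ≡ false → indeg D v ≤ deg G v)
proposition17 G S k DS (isOriS , properS , _) crowded
  with properOutsideS-extension G S (extendOutwards G S DS) (extendOutwards-isOrientation G S DS isOriS)
... | D , isOri , agree , properOut =
  D , (isOri , isProper-extendOutwards G S agree crowded properS properOut , indeg≤Δ)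
    , (λ u v _ v∈S _ → agreeDS G S agree u v∈S)
    , (λ v v∈S → indeg-inS G S agree v∈S)
    , (λ v _ → indeg≤deg G D isOri v)
  where
  indeg≤Δ : ∀ v → indeg D v ≤ Δ G
  indeg≤Δ v = ≤-trans (indeg≤deg G D isOri v) (maxFin-upperBound (deg G) v)
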